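{- Let $0 \leq k \leq n$ be integers. Then $F(n+2,k+1) \geq F(n,k)^2$.
   Context: $Q_n$ is the $n$-dimensional Boolean hypercube with vertex set $\{ -1,1\}^n$, two vertices being adjacent iff they differ in exactly one coordinate; $\Gamma(x)$ denotes the neighbourhood of $x$. A Boolean function on $Q_n$ is a function $f:\{ -1,1\}^n\to\{ -1,1\}$. A $k$-function is a Boolean function $f$ on $Q_n$ such that for every vertex $v$, $|\{w\in\Gamma(v): f(v)\neq f(w)\}|=k$. $F(n,k)$ denotes the number of $k$-functions on $Q_n$. -}

module Defs where

open import Data.Bool using (Bool; true; false; not; if_then_else_)
open import Data.Nat using (ℕ; zero; suc; _+_)
open import Data.Fin using (Fin)
open import Data.Vec using (Vec; []; _∷_; updateAt)
open import Data.List using (List; []; _∷_; map; concatMap; filter; length; allFin)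
open import Data.Product using (_×_; _,_)
open import Relation.Binary.PropositionalEquality using (_≡_)
open import Relation.Nullary using (¬_; ¬?; Dec)
open import Data.List.Relation.Unary.All using (All; all?)
open import Data.Bool.Properties using () renaming (_≟_ to _≟B_)
open import Data.Nat.Properties using () renaming (_≟_ to _≟ℕ_)

-- Vertices of Q_n: Vec Bool n  (true ↔ +1, false ↔ -1).
Vertex : ℕ → Set
Vertex n = Vec Bool n

BoolFun : ℕ → Set
BoolFun n = Vertex n → Bool

flip : ∀ {n} → Fin n → Vertex n → Vertex n
flip i v = updateAt v i not

disagree : ∀ {n} → BoolFun n → Vertex n → ℕ
disagree {n} f v = length (filter (λ i → ¬? (f v ≟B f (flip i v))) (allFin n))

IsKFunction : ∀ {n} → ℕ → BoolFun n → Set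
IsKFunction {n} k f = ∀ (v : Vertex n) → disagree f v ≡ k

-- Finite enumeration of all Boolean functions on Q_n, via their
-- decision-tree (truth table) representation.
Table : ℕ → Set
Table zero = Bool
Table (suc n) = Table n × Table n

eval : ∀ {n} → Table n → BoolFun n
eval {zero} b [] = b
eval {suc n} (t , u) (true ∷ v) = eval t v
eval {suc n} (t , u) (false ∷ v) = eval u v

allTables : (n : ℕ) → List (Table n)
allTables zero = true ∷ false ∷ []
allTables (suc n) = concatMap (λ t → map (λ u → (t , u)) (allTables n)) (allTables n)

allVertices : (n : ℕ) → List (Vertex n)
allVertices zero = [] ∷ []
allVertices (suc n) = concatMap (λ v → (true ∷ v) ∷ (false ∷ v) ∷ []) (allVertices n)

isKFun? : ∀ {n} (k : ℕ) (t : Table n) → Dec (All (λ v → disagree (eval t) v ≡ k) (allVertices n))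
isKFun? {n} k t = all? (λ v → disagree (eval t) v ≟ℕ k) (allVertices n)

F : ℕ → ℕ → ℕ
F n k = length (filter (isKFun? k) (allTables n))

{-# OPTIONS --safe #-}
module Submission where

-- From k-functions f, g on Q_n build h on Q_(n+2) by
--   h(1,1,x) = f x,  h(1,-1,x) = g x,  h(-1,1,x) = ¬ g x,  h(-1,-1,x) = ¬ f x.
-- Each of the four copies of Q_n carries a k-function (negation preserves
-- k-functions), and of the two neighbours of (a,b,x) across the new
-- coordinates, (¬a,b,x) and (a,¬b,x), h takes complementary values there, so
-- exactly one of them disagrees with h(a,b,x). Hence h is a (k+1)-function;
-- it is injective in (f,g), as it restricts to f and g on the half a = 1.

open import Defs
open import Data.Bool using (Bool; true; false; not; if_then_else_)
open import Data.Bool.Properties using (_≟_; not-involutive; not-injective)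
open import Data.Nat using (ℕ; zero; suc; _+_; _*_; _≤_; z≤n)
open import Data.Nat.Properties using (+-comm; *-zeroʳ; *-distribˡ-+; *-distribʳ-+; +-mono-≤; module ≤-Reasoning)
open import Data.Fin using (Fin)
import Data.Fin as Fin
open import Data.Vec using ([]; _∷_)
open import Data.List using (List; []; _∷_; _++_; map; concatMap; filter; length; tabulate; allFin; cartesianProduct)
open import Data.List.Properties using (filter-++; length-++; filter-≐)
open import Data.List.Membership.Propositional using (_∈_)
open import Data.List.Membership.Propositional.Properties using (∈-map⁺; ∈-filter⁺; ∈-length; ∈-concatMap⁺; ∈-cartesianProduct⁺)
open import Data.List.Relation.Unary.All using (All)
import Data.List.Relation.Unary.All as All
open import Data.List.Relation.Unary.Any using (here; there)
import Data.List.Relation.Unary.Any as Any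
open import Data.Product using (_×_; _,_; ∃-syntax)
open import Function using (_∘_)
open import Level using (Level)
open import Relation.Binary.PropositionalEquality
open import Relation.Nullary using (Dec; yes; no; does; ¬?; _×-dec_)
open import Relation.Unary using (Pred; Decidable; _⟨×⟩_)
open import Relation.Unary.Properties using (_×?_)

private
  variable
    a b p q : Level
    A : Set a
    B : Set b

iverson : {P : Set p} → Dec P → ℕ
iverson P? = if does P? then 1 else 0

module _ {P : Pred A p} (P? : Decidable P) where

  count : List A → ℕ
  count = length ∘ filter P?

  count-∷ : ∀ x xs → count (x ∷ xs) ≡ iverson (P? x) + count xs
  count-∷ x xs with P? x
  ... | yes _ = refl
  ... | no _  = refl

  count-++ : ∀ xs ys → count (xs ++ ys) ≡ count xs + count ys
  count-++ xs ys = trans (cong length (filter-++ P? xs ys)) (length-++ (filter P? xs))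

  count-pos : ∀ {x xs} → x ∈ xs → P x → 1 ≤ count xs
  count-pos x∈xs px = ∈-length (∈-filter⁺ P? x∈xs px)

count-tabulate : ∀ {P : Pred A p} (P? : Decidable P) {n} (f : Fin n → A) →
                 count P? (tabulate f) ≡ count (P? ∘ f) (allFin n)
count-tabulate P? {zero}  f = refl
count-tabulate P? {suc n} f = begin
  count P? (f Fin.zero ∷ tabulate (f ∘ Fin.suc))
    ≡⟨ count-∷ P? (f Fin.zero) (tabulate (f ∘ Fin.suc)) ⟩
  iverson (P? (f Fin.zero)) + count P? (tabulate (f ∘ Fin.suc))
    ≡⟨ cong (iverson (P? (f Fin.zero)) +_) (count-tabulate P? (f ∘ Fin.suc)) ⟩
  iverson (P? (f Fin.zero)) + count (P? ∘ f ∘ Fin.suc) (allFin n)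
    ≡⟨ cong (iverson (P? (f Fin.zero)) +_) (sym (count-tabulate (P? ∘ f) Fin.suc)) ⟩
  iverson (P? (f Fin.zero)) + count (P? ∘ f) (tabulate Fin.suc)
    ≡⟨ sym (count-∷ (P? ∘ f) Fin.zero (tabulate Fin.suc)) ⟩
  count (P? ∘ f) (allFin (suc n)) ∎
  where open ≡-Reasoning

iverson-×-dec : {P : Set p} {Q : Set q} (P? : Dec P) (Q? : Dec Q) →
                iverson (P? ×-dec Q?) ≡ iverson P? * iverson Q?
iverson-×-dec (yes _) (yes _) = refl
iverson-×-dec (yes _) (no _)  = refl
iverson-×-dec (no _)  _       = refl

module _ {P : Pred A p} {Q : Pred B q} (P? : Decidable P) (Q? : Decidable Q) where

  count-map-pair : ∀ x ys → count (P? ×? Q?) (map (x ,_) ys) ≡ iverson (P? x) * count Q? ys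
  count-map-pair x [] = sym (*-zeroʳ (iverson (P? x)))
  count-map-pair x (y ∷ ys) = begin
    count (P? ×? Q?) ((x , y) ∷ map (x ,_) ys)
      ≡⟨ count-∷ (P? ×? Q?) (x , y) (map (x ,_) ys) ⟩
    iverson (P? x ×-dec Q? y) + count (P? ×? Q?) (map (x ,_) ys)
      ≡⟨ cong₂ _+_ (iverson-×-dec (P? x) (Q? y)) (count-map-pair x ys) ⟩
    iverson (P? x) * iverson (Q? y) + iverson (P? x) * count Q? ys
      ≡⟨ sym (*-distribˡ-+ (iverson (P? x)) (iverson (Q? y)) (count Q? ys)) ⟩
    iverson (P? x) * (iverson (Q? y) + count Q? ys)
      ≡⟨ cong (iverson (P? x) *_) (sym (count-∷ Q? y ys)) ⟩
    iverson (P? x) * count Q? (y ∷ ys) ∎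
    where open ≡-Reasoning

  count-cartesianProduct : ∀ xs ys → count (P? ×? Q?) (cartesianProduct xs ys) ≡ count P? xs * count Q? ys
  count-cartesianProduct [] ys = refl
  count-cartesianProduct (x ∷ xs) ys = begin
    count (P? ×? Q?) (map (x ,_) ys ++ cartesianProduct xs ys)
      ≡⟨ count-++ (P? ×? Q?) (map (x ,_) ys) (cartesianProduct xs ys) ⟩
    count (P? ×? Q?) (map (x ,_) ys) + count (P? ×? Q?) (cartesianProduct xs ys)
      ≡⟨ cong₂ _+_ (count-map-pair x ys) (count-cartesianProduct xs ys) ⟩
    iverson (P? x) * count Q? ys + count P? xs * count Q? ys
      ≡⟨ sym (*-distribʳ-+ (count Q? ys) (iverson (P? x)) (count P? xs)) ⟩
    (iverson (P? x) + count P? xs) * count Q? ys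
      ≡⟨ cong (_* count Q? ys) (sym (count-∷ P? x xs)) ⟩
    count P? (x ∷ xs) * count Q? ys ∎
    where open ≡-Reasoning

module _ {P : Pred A p} {R : Pred (A × B) q} (P? : Decidable P) (R? : Decidable R) {ys : List B}
         (extend : ∀ {x} → P x → ∃[ y ] y ∈ ys × R (x , y)) where

  count-≤-cartesianProduct : ∀ xs → count P? xs ≤ count R? (cartesianProduct xs ys)
  count-≤-cartesianProduct [] = z≤n
  count-≤-cartesianProduct (x ∷ xs) = begin
    count P? (x ∷ xs)                                         ≡⟨ count-∷ P? x xs ⟩
    iverson (P? x) + count P? xs                              ≤⟨ +-mono-≤ (iverson≤count (P? x)) (count-≤-cartesianProduct xs) ⟩
    count R? (map (x ,_) ys) + count R? (cartesianProduct xs ys) ≡⟨ count-++ R? (map (x ,_) ys) (cartesianProduct xs ys) ⟨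
    count R? (cartesianProduct (x ∷ xs) ys)                   ∎
    where
    open ≤-Reasoning
    iverson≤count : (px? : Dec (P x)) → iverson px? ≤ count R? (map (x ,_) ys)
    iverson≤count (yes px) with extend px
    ... | y , y∈ys , rxy = count-pos R? (∈-map⁺ (x ,_) y∈ys) rxy
    iverson≤count (no _) = z≤n

_≢?_ : (b c : Bool) → Dec (b ≢ c)
b ≢? c = ¬? (b ≟ c)

disagree-∷ : ∀ {n} (h : BoolFun (suc n)) x v →
             disagree h (x ∷ v) ≡ iverson (h (x ∷ v) ≢? h (not x ∷ v)) + disagree (λ w → h (x ∷ w)) v
disagree-∷ {n} h x v =
  trans (count-∷ differs Fin.zero (tabulate Fin.suc)) (cong (iverson (differs Fin.zero) +_) (count-tabulate differs Fin.suc))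
  where
  differs : Decidable (λ i → h (x ∷ v) ≢ h (flip i (x ∷ v)))
  differs i = h (x ∷ v) ≢? h (flip i (x ∷ v))

disagree-cong : ∀ {n} {f g : BoolFun n} → (∀ v → f v ≡ g v) → ∀ v → disagree f v ≡ disagree g v
disagree-cong {n} {f} {g} f≗g v = cong length (filter-≐ _ _ (to , from) (allFin n))
  where
  to : ∀ {i} → f v ≢ f (flip i v) → g v ≢ g (flip i v)
  to ne eq = ne (trans (f≗g v) (trans eq (sym (f≗g _))))
  from : ∀ {i} → g v ≢ g (flip i v) → f v ≢ f (flip i v)
  from ne eq = ne (trans (sym (f≗g v)) (trans eq (f≗g _)))

disagree-not : ∀ {n} (f : BoolFun n) v → disagree (not ∘ f) v ≡ disagree f v
disagree-not {n} f v = cong length (filter-≐ _ _ ((λ ne → ne ∘ cong not) , (λ ne → ne ∘ not-injective)) (allFin n))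

bothSigns : ∀ {n} → Vertex n → List (Vertex (suc n))
bothSigns v = (true ∷ v) ∷ (false ∷ v) ∷ []

∈-allVertices : ∀ {n} (v : Vertex n) → v ∈ allVertices n
∈-allVertices {zero}  [] = here refl
∈-allVertices {suc n} (true ∷ v)  = ∈-concatMap⁺ bothSigns (Any.map (λ { refl → here refl }) (∈-allVertices v))
∈-allVertices {suc n} (false ∷ v) = ∈-concatMap⁺ bothSigns (Any.map (λ { refl → there (here refl) }) (∈-allVertices v))

all-allVertices : ∀ {n ℓ} {P : Pred (Vertex n) ℓ} → All P (allVertices n) → ∀ v → P v
all-allVertices all v = All.lookup all (∈-allVertices v)

concatMap-pairs : (xs : List A) (ys : List B) → concatMap (λ x → map (x ,_) ys) xs ≡ cartesianProduct xs ys
concatMap-pairs []       ys = refl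
concatMap-pairs (x ∷ xs) ys = cong (map (x ,_) ys ++_) (concatMap-pairs xs ys)

allTables-suc : ∀ n → allTables (suc n) ≡ cartesianProduct (allTables n) (allTables n)
allTables-suc n = concatMap-pairs (allTables n) (allTables n)

∈-allTables : ∀ {n} (t : Table n) → t ∈ allTables n
∈-allTables {zero}  true  = here refl
∈-allTables {zero}  false = there (here refl)
∈-allTables {suc n} (t , u) =
  subst ((t , u) ∈_) (sym (allTables-suc n)) (∈-cartesianProduct⁺ (∈-allTables t) (∈-allTables u))

complement : ∀ {n} → Table n → Table n
complement {zero}  x       = not x
complement {suc n} (t , u) = complement t , complement u

eval-complement : ∀ {n} (t : Table n) v → eval (complement t) v ≡ not (eval t v)
eval-complement {zero}  x       []          = refl
eval-complement {suc n} (t , u) (true ∷ v)  = eval-complement t v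
eval-complement {suc n} (t , u) (false ∷ v) = eval-complement u v

isKFunction-complement : ∀ {n k} (t : Table n) → IsKFunction k (eval t) → IsKFunction k (eval (complement t))
isKFunction-complement t kt v = trans (disagree-cong (eval-complement t) v) (trans (disagree-not (eval t) v) (kt v))

double : ∀ {n} → Table n → Table n → Table (suc (suc n))
double f g = (f , g) , (complement g , complement f)

module _ {n : ℕ} (f g : Table n) where

  double-complementary : ∀ x y v → eval (double f g) (not x ∷ y ∷ v) ≡ not (eval (double f g) (x ∷ not y ∷ v))
  double-complementary true  true  v = eval-complement g v
  double-complementary true  false v = eval-complement f v
  double-complementary false true  v = sym (trans (cong not (eval-complement f v)) (not-involutive _))
  double-complementary false false v = sym (trans (cong not (eval-complement g v)) (not-involutive _))

  isKFunction-double : ∀ {k} → IsKFunction k (eval f) → IsKFunction k (eval g) → IsKFunction (suc k) (eval (double f g))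
  isKFunction-double {k} kf kg (x ∷ y ∷ v) = begin
    disagree h (x ∷ y ∷ v)
      ≡⟨ disagree-∷ h x (y ∷ v) ⟩
    iverson (h (x ∷ y ∷ v) ≢? h (not x ∷ y ∷ v)) + disagree (λ w → h (x ∷ w)) (y ∷ v)
      ≡⟨ cong (iverson (h (x ∷ y ∷ v) ≢? h (not x ∷ y ∷ v)) +_) (disagree-∷ (λ w → h (x ∷ w)) y v) ⟩
    iverson (h (x ∷ y ∷ v) ≢? h (not x ∷ y ∷ v)) + (iverson (h (x ∷ y ∷ v) ≢? h (x ∷ not y ∷ v)) + disagree (slice x y) v)
      ≡⟨ cong₂ (λ b d → iverson (h (x ∷ y ∷ v) ≢? b) + (iverson (h (x ∷ y ∷ v) ≢? h (x ∷ not y ∷ v)) + d))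
               (double-complementary x y v) (isKFunction-slice x y v) ⟩
    iverson (h (x ∷ y ∷ v) ≢? not (h (x ∷ not y ∷ v))) + (iverson (h (x ∷ y ∷ v) ≢? h (x ∷ not y ∷ v)) + k)
      ≡⟨ exactly-one (h (x ∷ y ∷ v)) (h (x ∷ not y ∷ v)) ⟩
    suc k ∎
    where
    open ≡-Reasoning
    h : BoolFun (suc (suc n))
    h = eval (double f g)
    slice : Bool → Bool → BoolFun n
    slice x y w = h (x ∷ y ∷ w)
    isKFunction-slice : ∀ x y → IsKFunction k (slice x y)
    isKFunction-slice true  true  = kf
    isKFunction-slice true  false = kg
    isKFunction-slice false true  = isKFunction-complement g kg
    isKFunction-slice false false = isKFunction-complement f kf
    exactly-one : ∀ b c → iverson (b ≢? not c) + (iverson (b ≢? c) + k) ≡ suc k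
    exactly-one true  true  = refl
    exactly-one true  false = refl
    exactly-one false true  = refl
    exactly-one false false = refl

IsKTable : ∀ {n} → ℕ → Table n → Set
IsKTable {n} k t = All (λ v → disagree (eval t) v ≡ k) (allVertices n)

isKTable-double : ∀ {n k} (f g : Table n) → IsKTable k f → IsKTable k g → IsKTable (suc k) (double f g)
isKTable-double f g kf kg = All.tabulate (λ {v} _ → isKFunction-double f g (all-allVertices kf) (all-allVertices kg) v)

corollary1 : (n k : ℕ) → k ≤ n → F n k * F n k ≤ F (n + 2) (k + 1)
corollary1 n k _ rewrite +-comm n 2 | +-comm k 1 = begin
  count K (allTables n) * count K (allTables n)
    ≡⟨ count-cartesianProduct K K (allTables n) (allTables n) ⟨
  count (K ×? K) (cartesianProduct (allTables n) (allTables n))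
    ≡⟨ cong (count (K ×? K)) (allTables-suc n) ⟨
  count (K ×? K) (allTables (suc n))
    ≤⟨ count-≤-cartesianProduct (K ×? K) K′ extend (allTables (suc n)) ⟩
  count K′ (cartesianProduct (allTables (suc n)) (allTables (suc n)))
    ≡⟨ cong (count K′) (allTables-suc (suc n)) ⟨
  count K′ (allTables (suc (suc n))) ∎
  where
  open ≤-Reasoning
  K : Decidable (IsKTable {n} k)
  K = isKFun? k
  K′ : Decidable (IsKTable {suc (suc n)} (suc k))
  K′ = isKFun? (suc k)
  extend : ∀ {t} → (IsKTable k ⟨×⟩ IsKTable k) t → ∃[ u ] u ∈ allTables (suc n) × IsKTable (suc k) (t , u)
  extend {f , g} (kf , kg) = (complement g , complement f) , ∈-allTables _ , isKTable-double f g kf kg
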